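{- Let $r\ge 1$ and let $G$ be a graph with $\Delta(G)\le r$. Let $T$ be a cluster of $G$, let $S=\bigcap_{x\in T}N(x)$ and let $R$ be the complement of $G[S]$ (the graph on vertex set $S$ whose edges are the pairs of $S$ that are non-adjacent in $G$). Then for every $x\in S$, \[ |N_G(x)\setminus (T\cup S)|\le d_R(x), \] and the folded graph $G_T = G+\binom{S}{2}-[S,V(G)\setminus(T\cup S)]$ satisfies $\Delta(G_T)\le r$.
   Context: For an edge $xy$ of $G$, its weight is $w(xy)=|N(x)\cap N(y)|$. An edge is tight if $w(xy)=r-1$. A tight clique is a clique all of whose edges are tight, and a cluster is a maximal tight clique with at least two vertices (equivalently, the vertex set of a component with at least one edge of the graph of tight edges); every vertex of a cluster has degree $r$ and closed neighborhood $T\cup S$, so $|T|+|S|=r+1$. Here $G+\binom{S}{2}-[S,V(G)\setminus(T\cup S)]$ is the graph obtained from $G$ by adding all edges between pairs of vertices of $S$ and deleting all edges between $S$ and vertices outside $T\cup S$. -}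

module Defs where

open import Data.Nat using (ℕ; _∸_; _≤_)
open import Data.Bool using (Bool; true; false; _∧_; _∨_; not; if_then_else_)
open import Data.Bool.Properties using (∧-comm; ∨-comm)
open import Data.Fin using (Fin; _≟_)
open import Data.Fin.Subset using (Subset; _∈_; _⊆_; _∩_; _∪_; ∁; ∣_∣; ⁅_⁆; _─_)
open import Data.Vec using (lookup; tabulate)
open import Data.List using (allFin)
open import Data.Bool.ListAction using (all)
open import Data.Product using (_×_)
open import Relation.Nullary using (¬_)
open import Relation.Nullary.Decidable using (⌊_⌋)
open import Relation.Binary.PropositionalEquality using (_≡_; refl; sym; cong)

record Graph (n : ℕ) : Set where
  field
    adj    : Fin n → Fin n → Bool
    adj-sym : ∀ x y → adj x y ≡ adj y x
    adj-irr : ∀ x → adj x x ≡ false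
open Graph public

module _ {n : ℕ} (G : Graph n) where

  N : Fin n → Subset n
  N x = tabulate (adj G x)

  deg : Fin n → ℕ
  deg x = ∣ N x ∣

  MaxDeg≤ : ℕ → Set
  MaxDeg≤ r = ∀ x → deg x ≤ r

  w : Fin n → Fin n → ℕ
  w x y = ∣ N x ∩ N y ∣

  Tight : ℕ → Fin n → Fin n → Set
  Tight r x y = (adj G x y ≡ true) × (w x y ≡ r ∸ 1)

  TightClique : ℕ → Subset n → Set
  TightClique r T = ∀ x y → x ∈ T → y ∈ T → ¬ (x ≡ y) → Tight r x y

  Cluster : ℕ → Subset n → Set
  Cluster r T = TightClique r T × (2 ≤ ∣ T ∣)
              × (∀ T′ → TightClique r T′ → T ⊆ T′ → T′ ⊆ T)

  -- S = ⋂_{x ∈ T} N(x)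
  CommonNbhd : Subset n → Subset n
  CommonNbhd T = tabulate (λ v → all (λ x → not (lookup T x) ∨ adj G x v) (allFin n))

  -- degree of x in R, the complement of G[S]:
  -- number of y ∈ S with y ≠ x and y not adjacent to x in G
  degCompl : Subset n → Fin n → ℕ
  degCompl S x = ∣ (S ─ N x) ─ ⁅ x ⁆ ∣

  -- the folded graph G + (S choose 2) − [S, V(G) ∖ (T ∪ S)]
  -- (membership tests are Booleans: lookup S u ≡ true iff u ∈ S)
  foldAdj : Subset n → Subset n → Fin n → Fin n → Bool
  foldAdj T S u v =
    if lookup S u ∧ lookup S v then not ⌊ u ≟ v ⌋
    else if (lookup S u ∧ not (lookup (T ∪ S) v)) ∨ (lookup S v ∧ not (lookup (T ∪ S) u))
         then false
         else adj G u v

  private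
    ≟-sym : ∀ (u v : Fin n) → ⌊ u ≟ v ⌋ ≡ ⌊ v ≟ u ⌋
    ≟-sym u v with u ≟ v | v ≟ u
    ... | Relation.Nullary.yes _ | Relation.Nullary.yes _ = refl
    ... | Relation.Nullary.no _  | Relation.Nullary.no _  = refl
    ... | Relation.Nullary.yes p | Relation.Nullary.no q  = Data.Empty.⊥-elim (q (sym p))
      where import Data.Empty
    ... | Relation.Nullary.no p  | Relation.Nullary.yes q = Data.Empty.⊥-elim (p (sym q))
      where import Data.Empty

    foldAdj-sym : ∀ T S u v → foldAdj T S u v ≡ foldAdj T S v u
    foldAdj-sym T S u v
      rewrite ∧-comm (lookup S u) (lookup S v)
            | ∨-comm (lookup S u ∧ not (lookup (T ∪ S) v)) (lookup S v ∧ not (lookup (T ∪ S) u))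
            | ≟-sym u v
            | adj-sym G u v = refl

    foldAdj-irr : ∀ T S u → foldAdj T S u u ≡ false
    foldAdj-irr T S u with lookup S u | u ≟ u
    ... | true  | Relation.Nullary.yes _ = refl
    ... | true  | Relation.Nullary.no p  = Data.Empty.⊥-elim (p refl)
      where import Data.Empty
    ... | false | _ = adj-irr G u

  Fold : Subset n → Graph n
  Fold T = record
    { adj = foldAdj T (CommonNbhd T)
    ; adj-sym = foldAdj-sym T (CommonNbhd T)
    ; adj-irr = foldAdj-irr T (CommonNbhd T) }

-- If tt′ is a tight edge and Δ(G) ≤ r, then N(t) contains the r − 1 common neighbours of t and t′
-- together with t′ itself, so deg t = r and N(t) ∖ {t′} ⊆ N(t′).  Hence every vertex outside T
-- that is adjacent to one vertex t₀ of the cluster is adjacent to all of T, i.e. T ∪ S is the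
-- closed neighbourhood of t₀ and |T| + |S| = r + 1.  A vertex x ∈ S sees all of T, so of its
-- at most r = |T| + |S| − 1 neighbours, those outside T ∪ S are at most as many as the vertices
-- of S ∖ {x} it misses.  In the folded graph a vertex u ∈ S has its neighbourhood inside
-- (T ∪ S) ∖ {u}, of size r, and every other vertex only loses neighbours.

module Submission where

open import Data.Nat using (ℕ; zero; suc; _+_; _≤_; _<_; z≤n; s≤s; s≤s⁻¹)
open import Data.Nat.Properties
  using (≤-trans; ≤-reflexive; ≤-antisym; +-comm; +-assoc; +-suc; +-mono-≤; +-monoˡ-≤; <⇒≱; suc-injective; +-cancelˡ-≤; module ≤-Reasoning)
open import Data.Bool using (Bool; true; false; not; _∧_; _∨_) renaming (T to True)
open import Data.Bool.Properties using (T-≡)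
open import Data.Fin using (Fin; _≟_) renaming (zero to fzero; suc to fsuc)
open import Data.Fin.Subset
open import Data.Fin.Subset.Properties
open import Data.Vec using ([]; _∷_; here; there; lookup; tabulate)
open import Data.Vec.Properties using (lookup∘tabulate; []=⇒lookup; lookup⇒[]=)
open import Data.List using (allFin)
open import Data.List.Membership.Propositional.Properties using (∈-allFin)
import Data.List.Relation.Unary.All as All
open import Data.List.Relation.Unary.All.Properties using (all⁺; all⁻)
open import Data.Product using (∃-syntax; _×_; _,_; proj₁)
open import Data.Sum using (inj₁; inj₂)
open import Data.Unit using (tt)
open import Function using (_∘_; Equivalence)
open import Relation.Nullary using (yes; no; contradiction)
open import Relation.Binary.PropositionalEquality

open import Defs

private variable
  n : ℕ
  x : Fin n
  p q : Subset n

∣p∣≡∣p∩q∣+∣p─q∣ : ∀ (p q : Subset n) → ∣ p ∣ ≡ ∣ p ∩ q ∣ + ∣ p ─ q ∣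
∣p∣≡∣p∩q∣+∣p─q∣ []            []            = refl
∣p∣≡∣p∩q∣+∣p─q∣ (outside ∷ p) (inside  ∷ q) = ∣p∣≡∣p∩q∣+∣p─q∣ p q
∣p∣≡∣p∩q∣+∣p─q∣ (outside ∷ p) (outside ∷ q) = ∣p∣≡∣p∩q∣+∣p─q∣ p q
∣p∣≡∣p∩q∣+∣p─q∣ (inside  ∷ p) (inside  ∷ q) = cong suc (∣p∣≡∣p∩q∣+∣p─q∣ p q)
∣p∣≡∣p∩q∣+∣p─q∣ (inside  ∷ p) (outside ∷ q) =
  trans (cong suc (∣p∣≡∣p∩q∣+∣p─q∣ p q)) (sym (+-suc _ _))

p∩∁q≡p─q : ∀ (p q : Subset n) → p ∩ ∁ q ≡ p ─ q
p∩∁q≡p─q []            []            = refl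
p∩∁q≡p─q (outside ∷ p) (inside  ∷ q) = cong (outside ∷_) (p∩∁q≡p─q p q)
p∩∁q≡p─q (inside  ∷ p) (inside  ∷ q) = cong (outside ∷_) (p∩∁q≡p─q p q)
p∩∁q≡p─q (outside ∷ p) (outside ∷ q) = cong (outside ∷_) (p∩∁q≡p─q p q)
p∩∁q≡p─q (inside  ∷ p) (outside ∷ q) = cong (inside ∷_) (p∩∁q≡p─q p q)

x∈p─q⇒x∉q : x ∈ p ─ q → x ∉ q
x∈p─q⇒x∉q {p = _ ∷ _} {q = outside ∷ q} (there x∈p─q) (there x∈q) = x∈p─q⇒x∉q x∈p─q x∈q
x∈p─q⇒x∉q {p = _ ∷ _} {q = inside  ∷ q} (there x∈p─q) (there x∈q) = x∈p─q⇒x∉q x∈p─q x∈q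

∣p∣≡1+∣p-x∣ : x ∈ p → ∣ p ∣ ≡ suc ∣ p - x ∣
∣p∣≡1+∣p-x∣ {x = fzero}  {p = inside ∷ p} here        = cong suc (cong ∣_∣ (sym (p─⊥≡p p)))
∣p∣≡1+∣p-x∣ {x = fsuc x} {p = outside ∷ p} (there x∈p) = ∣p∣≡1+∣p-x∣ x∈p
∣p∣≡1+∣p-x∣ {x = fsuc x} {p = inside ∷ p} (there x∈p) = cong suc (∣p∣≡1+∣p-x∣ x∈p)

x∈p⇒0<∣p∣ : x ∈ p → 0 < ∣ p ∣
x∈p⇒0<∣p∣ x∈p rewrite ∣p∣≡1+∣p-x∣ x∈p = s≤s z≤n

0<∣p∣⇒Nonempty : 0 < ∣ p ∣ → Nonempty p
0<∣p∣⇒Nonempty {p = inside  ∷ p} _ = fzero , here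
0<∣p∣⇒Nonempty {p = outside ∷ p} 0<∣p∣ with 0<∣p∣⇒Nonempty 0<∣p∣
... | x , x∈p = fsuc x , there x∈p

x∈p∧y∈p∧∣p∣≤1⇒x≡y : ∀ {n} {p : Subset n} {x y} → x ∈ p → y ∈ p → ∣ p ∣ ≤ 1 → x ≡ y
x∈p∧y∈p∧∣p∣≤1⇒x≡y {p = p} {x} {y} x∈p y∈p ∣p∣≤1 with x ≟ y
... | yes x≡y = x≡y
... | no  x≢y = contradiction ∣p∣≤1 (<⇒≱ 1<∣p∣)
  where
  1<∣p∣ : 1 < ∣ p ∣
  1<∣p∣ = subst (1 <_) (sym (∣p∣≡1+∣p-x∣ y∈p)) (s≤s (x∈p⇒0<∣p∣ (x∈p∧x≢y⇒x∈p-y x∈p x≢y)))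

2≤∣p∣⇒∃distinct : ∀ {n} {p : Subset n} → 2 ≤ ∣ p ∣ → ∃[ x ] ∃[ y ] x ∈ p × y ∈ p × x ≢ y
2≤∣p∣⇒∃distinct {p = p} 2≤∣p∣ with 0<∣p∣⇒Nonempty (≤-trans (s≤s z≤n) 2≤∣p∣)
... | x , x∈p with 0<∣p∣⇒Nonempty (s≤s⁻¹ (subst (2 ≤_) (∣p∣≡1+∣p-x∣ x∈p) 2≤∣p∣))
... | y , y∈p-x =
  x , y , x∈p , p─q⊆p p ⁅ x ⁆ y∈p-x , λ { refl → x∈p─q⇒x∉q y∈p-x (x∈⁅x⁆ x) }

∣p∪q∣≡∣p∣+∣q∣ : Empty (p ∩ q) → ∣ p ∪ q ∣ ≡ ∣ p ∣ + ∣ q ∣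
∣p∪q∣≡∣p∣+∣q∣ {p = []}          {q = []}          _ = refl
∣p∪q∣≡∣p∣+∣q∣ {p = inside  ∷ p} {q = inside  ∷ q} p∩q=∅ = contradiction (fzero , here) p∩q=∅
∣p∪q∣≡∣p∣+∣q∣ {p = inside  ∷ p} {q = outside ∷ q} p∩q=∅ = cong suc (∣p∪q∣≡∣p∣+∣q∣ (drop-∷-Empty p∩q=∅))
∣p∪q∣≡∣p∣+∣q∣ {p = outside ∷ p} {q = inside  ∷ q} p∩q=∅ =
  trans (cong suc (∣p∪q∣≡∣p∣+∣q∣ (drop-∷-Empty p∩q=∅))) (sym (+-suc _ _))
∣p∪q∣≡∣p∣+∣q∣ {p = outside ∷ p} {q = outside ∷ q} p∩q=∅ = ∣p∪q∣≡∣p∣+∣q∣ (drop-∷-Empty p∩q=∅)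

∈tabulate⁺ : ∀ {n} {f : Fin n → Bool} {x} → f x ≡ true → x ∈ tabulate f
∈tabulate⁺ {f = f} {x} fx = lookup⇒[]= x (tabulate f) (trans (lookup∘tabulate f x) fx)

∈tabulate⁻ : ∀ {n} {f : Fin n → Bool} {x} → x ∈ tabulate f → f x ≡ true
∈tabulate⁻ {f = f} {x} x∈f = trans (sym (lookup∘tabulate f x)) ([]=⇒lookup x∈f)

module _ {n} (G : Graph n) where

  adj⇒∈N : ∀ {x y} → adj G x y ≡ true → y ∈ N G x
  adj⇒∈N = ∈tabulate⁺

  ∈N⇒adj : ∀ {x y} → y ∈ N G x → adj G x y ≡ true
  ∈N⇒adj = ∈tabulate⁻

  ∈N-sym : ∀ {x y} → y ∈ N G x → x ∈ N G y
  ∈N-sym {x} {y} y∈Nx = adj⇒∈N (trans (adj-sym G y x) (∈N⇒adj y∈Nx))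

  x∉Nx : ∀ x → x ∉ N G x
  x∉Nx x x∈Nx with () ← trans (sym (adj-irr G x)) (∈N⇒adj x∈Nx)

  ∈CommonNbhd⁻ : ∀ {T v x} → v ∈ CommonNbhd G T → x ∈ T → v ∈ N G x
  ∈CommonNbhd⁻ {T} {v} {x} v∈S x∈T =
    adj⇒∈N (Equivalence.to T-≡ (subst (λ b → True (not b ∨ adj G x v)) ([]=⇒lookup x∈T) Tfx))
    where
    Tfx : True (not (lookup T x) ∨ adj G x v)
    Tfx = All.lookup (all⁺ _ (allFin n) (Equivalence.from T-≡ (∈tabulate⁻ v∈S))) (∈-allFin x)

  ∈CommonNbhd⁺ : ∀ {T v} → (∀ {x} → x ∈ T → v ∈ N G x) → v ∈ CommonNbhd G T
  ∈CommonNbhd⁺ {T} {v} v∈N[T] =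
    ∈tabulate⁺ (Equivalence.to T-≡ (all⁻ _ {allFin n} (All.tabulate (λ {x} _ → True[x∉T∨v∈Nx] x))))
    where
    True[x∉T∨v∈Nx] : ∀ x → True (not (lookup T x) ∨ adj G x v)
    True[x∉T∨v∈Nx] x with lookup T x in Tx
    ... | false = tt
    ... | true  = Equivalence.from T-≡ (∈N⇒adj (v∈N[T] (lookup⇒[]= x T Tx)))

  ∈CommonNbhd⇒∉ : ∀ {T v} → v ∈ CommonNbhd G T → v ∉ T
  ∈CommonNbhd⇒∉ {v = v} v∈S v∈T = x∉Nx v (∈CommonNbhd⁻ v∈S v∈T)

  N[_] : Fin n → Subset n
  N[ x ] = N G x ∪ ⁅ x ⁆

  ∣N[x]∣≡1+deg : ∀ x → ∣ N[ x ] ∣ ≡ suc (deg G x)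
  ∣N[x]∣≡1+deg x = begin
    ∣ N G x ∪ ⁅ x ⁆ ∣       ≡⟨ ∣p∪q∣≡∣p∣+∣q∣ N∩⁅x⁆≡∅ ⟩
    deg G x + ∣ ⁅ x ⁆ ∣      ≡⟨ cong (deg G x +_) (∣⁅x⁆∣≡1 x) ⟩
    deg G x + 1             ≡⟨ +-comm (deg G x) 1 ⟩
    suc (deg G x)           ∎
    where
    open ≡-Reasoning
    N∩⁅x⁆≡∅ : Empty (N G x ∩ ⁅ x ⁆)
    N∩⁅x⁆≡∅ (y , y∈N∩⁅x⁆) with x∈p∩q⁻ (N G x) ⁅ x ⁆ y∈N∩⁅x⁆
    ... | y∈Nx , y∈⁅x⁆ = x∉Nx x (subst (_∈ N G x) (x∈⁅y⁆⇒x≡y x y∈⁅x⁆) y∈Nx)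

  module _ {r} (Δ≤1+r : MaxDeg≤ G (suc r)) where

    ∣N─N∣≡1 : ∀ {t t′} → Tight G (suc r) t t′ → ∣ N G t ─ N G t′ ∣ ≡ 1
    ∣N─N∣≡1 {t} {t′} (t∼t′ , w≡r) = ≤-antisym k≤1 (x∈p⇒0<∣p∣ t′∈N─N)
      where
      k : ℕ
      k = ∣ N G t ─ N G t′ ∣
      t′∈N─N : t′ ∈ N G t ─ N G t′
      t′∈N─N = x∈p∧x∉q⇒x∈p─q (adj⇒∈N t∼t′) (x∉Nx t′)
      k≤1 : k ≤ 1
      k≤1 = +-cancelˡ-≤ r k 1 (begin
        r + k                                 ≡⟨ cong (_+ k) w≡r ⟨
        w G t t′ + k                          ≡⟨ ∣p∣≡∣p∩q∣+∣p─q∣ (N G t) (N G t′) ⟨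
        deg G t                               ≤⟨ Δ≤1+r t ⟩
        suc r                                 ≡⟨ +-comm 1 r ⟩
        r + 1                                 ∎)
        where open ≤-Reasoning

    tight⇒deg≡1+r : ∀ {t t′} → Tight G (suc r) t t′ → deg G t ≡ suc r
    tight⇒deg≡1+r {t} {t′} t∼t′@(_ , w≡r) = begin
      deg G t                               ≡⟨ ∣p∣≡∣p∩q∣+∣p─q∣ (N G t) (N G t′) ⟩
      w G t t′ + ∣ N G t ─ N G t′ ∣         ≡⟨ cong₂ _+_ w≡r (∣N─N∣≡1 t∼t′) ⟩
      r + 1                                 ≡⟨ +-comm r 1 ⟩
      suc r                                 ∎
      where open ≡-Reasoning

    tight⇒Nt-t′⊆Nt′ : ∀ {t t′ v} → Tight G (suc r) t t′ → v ∈ N G t → v ≢ t′ → v ∈ N G t′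
    tight⇒Nt-t′⊆Nt′ {t} {t′} {v} t∼t′ v∈Nt v≢t′ with v ∈? N G t′
    ... | yes v∈Nt′ = v∈Nt′
    ... | no  v∉Nt′ = contradiction
      (x∈p∧y∈p∧∣p∣≤1⇒x≡y (x∈p∧x∉q⇒x∈p─q v∈Nt v∉Nt′)
                         (x∈p∧x∉q⇒x∈p─q (adj⇒∈N (proj₁ t∼t′)) (x∉Nx t′))
                         (≤-reflexive (∣N─N∣≡1 t∼t′)))
      v≢t′

    module ClusterProperties {T} (clique : TightClique G (suc r) T)
                             {t₀ t₁} (t₀∈T : t₀ ∈ T) (t₁∈T : t₁ ∈ T) (t₀≢t₁ : t₀ ≢ t₁) where

      private
        S : Subset n
        S = CommonNbhd G T

      T∩S≡∅ : Empty (T ∩ S)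
      T∩S≡∅ (v , v∈T∩S) with x∈p∩q⁻ T S v∈T∩S
      ... | v∈T , v∈S = ∈CommonNbhd⇒∉ v∈S v∈T

      T∪S⊆N[t₀] : T ∪ S ⊆ N[ t₀ ]
      T∪S⊆N[t₀] {v} v∈T∪S with x∈p∪q⁻ T S v∈T∪S
      ... | inj₂ v∈S = x∈p∪q⁺ (inj₁ (∈CommonNbhd⁻ v∈S t₀∈T))
      ... | inj₁ v∈T with v ≟ t₀
      ...   | yes refl = x∈p∪q⁺ (inj₂ (x∈⁅x⁆ t₀))
      ...   | no  v≢t₀ = x∈p∪q⁺ (inj₁ (adj⇒∈N (proj₁ (clique t₀ v t₀∈T v∈T (v≢t₀ ∘ sym)))))

      N[t₀]⊆T∪S : N[ t₀ ] ⊆ T ∪ S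
      N[t₀]⊆T∪S {v} v∈N[t₀] with v ∈? T
      ... | yes v∈T = x∈p∪q⁺ (inj₁ v∈T)
      ... | no  v∉T = x∈p∪q⁺ (inj₂ (∈CommonNbhd⁺ v∈N[T]))
        where
        v∈Nt₀ : v ∈ N G t₀
        v∈Nt₀ with x∈p∪q⁻ (N G t₀) ⁅ t₀ ⁆ v∈N[t₀]
        ... | inj₁ v∈Nt₀ = v∈Nt₀
        ... | inj₂ v∈⁅t₀⁆ = contradiction (subst (_∈ T) (sym (x∈⁅y⁆⇒x≡y t₀ v∈⁅t₀⁆)) t₀∈T) v∉T
        v∈N[T] : ∀ {x} → x ∈ T → v ∈ N G x
        v∈N[T] {x} x∈T with x ≟ t₀
        ... | yes refl = v∈Nt₀
        ... | no  x≢t₀ = tight⇒Nt-t′⊆Nt′ (clique t₀ x t₀∈T x∈T (x≢t₀ ∘ sym)) v∈Nt₀ λ { refl → v∉T x∈T }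

      ∣T∪S∣≡2+r : ∣ T ∪ S ∣ ≡ suc (suc r)
      ∣T∪S∣≡2+r = begin
        ∣ T ∪ S ∣         ≡⟨ cong ∣_∣ (⊆-antisym T∪S⊆N[t₀] N[t₀]⊆T∪S) ⟩
        ∣ N[ t₀ ] ∣       ≡⟨ ∣N[x]∣≡1+deg t₀ ⟩
        suc (deg G t₀)    ≡⟨ cong suc (tight⇒deg≡1+r (clique t₀ t₁ t₀∈T t₁∈T t₀≢t₁)) ⟩
        suc (suc r)       ∎
        where open ≡-Reasoning

      ∣N∩∁[T∪S]∣≤degCompl : ∀ {x} → x ∈ S → ∣ N G x ∩ ∁ (T ∪ S) ∣ ≤ degCompl G S x
      ∣N∩∁[T∪S]∣≤degCompl {x} x∈S = s≤s⁻¹ (+-cancelˡ-≤ (t + b) (suc o) (suc d) (begin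
        t + b + suc o                               ≡⟨ +-suc (t + b) o ⟩
        suc (t + b + o)                             ≤⟨ s≤s tbo≤deg ⟩
        suc (deg G x)                               ≤⟨ s≤s (Δ≤1+r x) ⟩
        suc (suc r)                                 ≡⟨ trans (sym ∣T∪S∣≡2+r) ∣T∪S∣≡t+b+1+d ⟩
        t + b + suc d                               ∎))
        where
        open ≤-Reasoning
        t b o d : ℕ
        t = ∣ T ∣
        b = ∣ S ∩ N G x ∣
        o = ∣ N G x ∩ ∁ (T ∪ S) ∣
        d = degCompl G S x
        ∣T∪S∣≡t+b+1+d : ∣ T ∪ S ∣ ≡ t + b + suc d
        ∣T∪S∣≡t+b+1+d = begin-equality
          ∣ T ∪ S ∣                               ≡⟨ ∣p∪q∣≡∣p∣+∣q∣ T∩S≡∅ ⟩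
          t + ∣ S ∣                               ≡⟨ cong (t +_) (∣p∣≡∣p∩q∣+∣p─q∣ S (N G x)) ⟩
          t + (b + ∣ S ─ N G x ∣)                 ≡⟨ cong (λ k → t + (b + k)) (∣p∣≡1+∣p-x∣ x∈S─Nx) ⟩
          t + (b + suc d)                         ≡⟨ +-assoc t b (suc d) ⟨
          t + b + suc d                           ∎
          where
          x∈S─Nx : x ∈ S ─ N G x
          x∈S─Nx = x∈p∧x∉q⇒x∈p─q x∈S (x∉Nx x)
        tbo≤deg : t + b + o ≤ deg G x
        tbo≤deg = begin
          t + b + o
            ≤⟨ +-monoˡ-≤ o (+-mono-≤ (p⊆q⇒∣p∣≤∣q∣ T⊆Nx∩T) (p⊆q⇒∣p∣≤∣q∣ S∩Nx⊆[Nx─T]∩S)) ⟩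
          ∣ N G x ∩ T ∣ + ∣ (N G x ─ T) ∩ S ∣ + o
            ≡⟨ +-assoc ∣ N G x ∩ T ∣ _ o ⟩
          ∣ N G x ∩ T ∣ + (∣ (N G x ─ T) ∩ S ∣ + o)
            ≡⟨ cong (λ k → ∣ N G x ∩ T ∣ + (∣ (N G x ─ T) ∩ S ∣ + ∣ k ∣)) Nx∩∁[T∪S]≡Nx─T─S ⟩
          ∣ N G x ∩ T ∣ + (∣ (N G x ─ T) ∩ S ∣ + ∣ N G x ─ T ─ S ∣)
            ≡⟨ cong (∣ N G x ∩ T ∣ +_) (∣p∣≡∣p∩q∣+∣p─q∣ (N G x ─ T) S) ⟨
          ∣ N G x ∩ T ∣ + ∣ N G x ─ T ∣
            ≡⟨ ∣p∣≡∣p∩q∣+∣p─q∣ (N G x) T ⟨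
          deg G x
            ∎
          where
          T⊆Nx∩T : T ⊆ N G x ∩ T
          T⊆Nx∩T v∈T = x∈p∩q⁺ (∈N-sym (∈CommonNbhd⁻ x∈S v∈T) , v∈T)
          S∩Nx⊆[Nx─T]∩S : S ∩ N G x ⊆ (N G x ─ T) ∩ S
          S∩Nx⊆[Nx─T]∩S v∈S∩Nx with x∈p∩q⁻ S (N G x) v∈S∩Nx
          ... | v∈S , v∈Nx = x∈p∩q⁺ (x∈p∧x∉q⇒x∈p─q v∈Nx (∈CommonNbhd⇒∉ v∈S) , v∈S)
          Nx∩∁[T∪S]≡Nx─T─S : N G x ∩ ∁ (T ∪ S) ≡ N G x ─ T ─ S
          Nx∩∁[T∪S]≡Nx─T─S = trans (p∩∁q≡p─q (N G x) (T ∪ S)) (sym (p─q─r≡p─q∪r (N G x) T S))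

      foldAdj-∈S : ∀ {u v} → u ∈ S → foldAdj G T S u v ≡ true → v ∈ (T ∪ S) - u
      foldAdj-∈S {u} {v} u∈S uv∈G_T with lookup S u | []=⇒lookup u∈S
      ... | .true | refl with lookup S v in Sv | u ≟ v | lookup (T ∪ S) v in [T∪S]v
      ... | true  | no u≢v | _     = x∈p∧x≢y⇒x∈p-y (x∈p∪q⁺ (inj₂ (lookup⇒[]= v S Sv))) (u≢v ∘ sym)
      ... | false | _      | true  =
        x∈p∧x≢y⇒x∈p-y (lookup⇒[]= v (T ∪ S) [T∪S]v) λ { refl → x∉Nx u (adj⇒∈N uv∈G_T) }
      foldAdj-∈S u∈S () | .true | refl | true  | yes _ | _
      foldAdj-∈S u∈S () | .true | refl | false | _     | false

      foldAdj-∉S : ∀ {u v} → u ∉ S → foldAdj G T S u v ≡ true → adj G u v ≡ true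
      foldAdj-∉S {u} {v} u∉S uv∈G_T with lookup S u in Su
      ... | true = contradiction (lookup⇒[]= u S Su) u∉S
      ... | false with lookup S v ∧ not (lookup (T ∪ S) u)
      ...   | false = uv∈G_T

      Δ[G_T]≤1+r : MaxDeg≤ (Fold G T) (suc r)
      Δ[G_T]≤1+r u with u ∈? S
      ... | no  u∉S = ≤-trans (p⊆q⇒∣p∣≤∣q∣ (adj⇒∈N ∘ foldAdj-∉S u∉S ∘ ∈tabulate⁻)) (Δ≤1+r u)
      ... | yes u∈S = begin
        deg (Fold G T) u      ≤⟨ p⊆q⇒∣p∣≤∣q∣ (foldAdj-∈S u∈S ∘ ∈tabulate⁻) ⟩
        ∣ (T ∪ S) - u ∣       ≡⟨ suc-injective (trans (sym (∣p∣≡1+∣p-x∣ u∈T∪S)) ∣T∪S∣≡2+r) ⟩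
        suc r                 ∎
        where
        open ≤-Reasoning
        u∈T∪S : u ∈ T ∪ S
        u∈T∪S = x∈p∪q⁺ (inj₂ u∈S)

mainTheorem2 : ∀ {n : ℕ} (r : ℕ) (G : Graph n) (T : Subset n)
    → 1 ≤ r
    → MaxDeg≤ G r
    → Cluster G r T
    → (∀ x → x ∈ CommonNbhd G T
         → ∣ N G x ∩ ∁ (T ∪ CommonNbhd G T) ∣ ≤ degCompl G (CommonNbhd G T) x)
      × MaxDeg≤ (Fold G T) r
mainTheorem2 zero    _ _ () _ _
mainTheorem2 (suc r) G T _ Δ≤1+r (clique , 2≤∣T∣ , _) with 2≤∣p∣⇒∃distinct 2≤∣T∣
... | t₀ , t₁ , t₀∈T , t₁∈T , t₀≢t₁ = (λ _ → ∣N∩∁[T∪S]∣≤degCompl) , Δ[G_T]≤1+r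
  where open ClusterProperties G Δ≤1+r clique t₀∈T t₁∈T t₀≢t₁
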